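{- (1) Let $G$ and $H$ be graphs such that the join $G\vee H$ is not a complete graph. Then $pvc(G\vee H)=spvc(G\vee H)=1$. (2) Let $G,H$ be two graphs and let $k$ be an integer with $2\leq k\leq \min\{|V(G)|,|V(H)|\}$. If $\delta(G)+\delta(H)<k-1$, where $\delta$ denotes the minimum degree, then $pvc_k(G\vee H)=2$; otherwise $pvc_k(G\vee H)=1$.
   Context: All graphs are simple, finite and undirected. The join $G\vee H$ has vertex set $V(G)\cup V(H)$ (disjoint union) and edge set $E(G)\cup E(H)\cup\{uv: u\in V(G), v\in V(H)\}$. A set of paths between two vertices is called disjoint if the paths are internally vertex-disjoint. In a vertex-colored graph, a path is vertex-proper if any two adjacent internal vertices of the path receive different colors. A vertex-colored graph is proper vertex $k$-connected if any two vertices are joined by $k$ disjoint vertex-proper paths. For a $k$-connected graph $G$, $pvc_k(G)$ is the smallest number of colors in a vertex-coloring making $G$ proper vertex $k$-connected; $pvc(G)=pvc_1(G)$, with the convention $pvc(G)=0$ for a complete graph $G$ (for $k\ge 2$, a coloring uses at least one color, so $pvc_k(G)\ge1$). A $u$-$v$ geodesic is a $u$-$v$ path of length equal to the distance $d(u,v)$. A vertex-colored graph is strong proper vertex-connected if for any two vertices $u,v$ there is a vertex-proper $u$-$v$ geodesic; $spvc(G)$ is the smallest number of colors needed for this, with $spvc(G)=0$ for a complete graph $G$. -}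

module Defs where

open import Data.Nat using (ℕ; zero; suc; _+_; _≤_)
open import Data.Bool using (Bool; true; false; if_then_else_)
open import Data.Fin using (Fin; splitAt)
open import Data.Sum using (_⊎_; inj₁; inj₂)
open import Data.Product using (Σ; _×_; _,_)
open import Data.List using (List; []; _∷_; _++_; [_]; length; map; allFin)
open import Data.Nat.ListAction using (sum)
open import Data.List.Relation.Unary.Linked using (Linked)
open import Data.List.Relation.Unary.Unique.Propositional using (Unique)
open import Data.List.Relation.Binary.Disjoint.Propositional using (Disjoint)
open import Relation.Binary.PropositionalEquality using (_≡_; _≢_; refl)

record Graph : Set where
  field
    n      : ℕ
    adj    : Fin n → Fin n → Bool
    sym    : ∀ u v → adj u v ≡ adj v u
    irrefl : ∀ v → adj v v ≡ false
open Graph public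

V : Graph → Set
V G = Fin (n G)

Edge : (G : Graph) → V G → V G → Set
Edge G u v = adj G u v ≡ true

-- Join: vertices of G come first (Fin (n G)), then those of H.
module _ (G H : Graph) where
  sumAdj : Fin (n G) ⊎ Fin (n H) → Fin (n G) ⊎ Fin (n H) → Bool
  sumAdj (inj₁ a) (inj₁ b) = adj G a b
  sumAdj (inj₂ a) (inj₂ b) = adj H a b
  sumAdj (inj₁ _) (inj₂ _) = true
  sumAdj (inj₂ _) (inj₁ _) = true

  sumAdj-sym : ∀ x y → sumAdj x y ≡ sumAdj y x
  sumAdj-sym (inj₁ a) (inj₁ b) = sym G a b
  sumAdj-sym (inj₂ a) (inj₂ b) = sym H a b
  sumAdj-sym (inj₁ _) (inj₂ _) = refl
  sumAdj-sym (inj₂ _) (inj₁ _) = refl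

  sumAdj-irrefl : ∀ x → sumAdj x x ≡ false
  sumAdj-irrefl (inj₁ a) = irrefl G a
  sumAdj-irrefl (inj₂ a) = irrefl H a

infixr 5 _∨_
_∨_ : Graph → Graph → Graph
G ∨ H = record
  { n      = n G + n H
  ; adj    = λ i j → sumAdj G H (splitAt (n G) i) (splitAt (n G) j)
  ; sym    = λ i j → sumAdj-sym G H (splitAt (n G) i) (splitAt (n G) j)
  ; irrefl = λ i → sumAdj-irrefl G H (splitAt (n G) i)
  }

Complete : Graph → Set
Complete G = ∀ (u v : V G) → u ≢ v → Edge G u v

deg : (G : Graph) → V G → ℕ
deg G v = sum (map (λ u → if adj G v u then 1 else 0) (allFin (n G)))

IsMinDegree : Graph → ℕ → Set
IsMinDegree G d = Σ (V G) (λ v → deg G v ≡ d) × (∀ v → d ≤ deg G v)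

-- A u-v path is given by its list of internal vertices `ins`;
-- the full vertex sequence is u ∷ ins ++ [ v ].  It must be a walk with
-- all vertices distinct.  Its length is length ins + 1.
IsPath : (G : Graph) → V G → V G → List (V G) → Set
IsPath G u v ins =
  Linked (Edge G) (u ∷ ins ++ [ v ]) × Unique (u ∷ ins ++ [ v ])

pathLength : ∀ {A : Set} → List A → ℕ
pathLength ins = suc (length ins)

VertexProper : ∀ {G : Graph} {t : ℕ} → (V G → Fin t) → List (V G) → Set
VertexProper c ins = Linked (λ a b → c a ≢ c b) ins

ProperKConnected : (k : ℕ) (G : Graph) {t : ℕ} → (V G → Fin t) → Set
ProperKConnected k G c =
  ∀ (u v : V G) → u ≢ v →
    Σ (Fin k → List (V G)) λ ps →
      (∀ i → IsPath G u v (ps i) × VertexProper {G} c (ps i)) ×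
      (∀ i j → i ≢ j → ps i ≢ ps j × Disjoint (ps i) (ps j))

IsGeodesic : (G : Graph) → V G → V G → List (V G) → Set
IsGeodesic G u v ins =
  IsPath G u v ins × (∀ ins′ → IsPath G u v ins′ → pathLength ins ≤ pathLength ins′)

StrongProperConnected : (G : Graph) {t : ℕ} → (V G → Fin t) → Set
StrongProperConnected G c =
  ∀ (u v : V G) → u ≢ v →
    Σ (List (V G)) λ ins → IsGeodesic G u v ins × VertexProper {G} c ins

IsMinimum : (ℕ → Set) → ℕ → Set
IsMinimum P t = P t × (∀ s → P s → t ≤ s)

-- pvc_k(G) = t  (for non-complete G, or k ≥ 2; the convention
-- pvc(K_n) = 0 is not needed for the theorem)
PvcIs : ℕ → Graph → ℕ → Set
PvcIs k G t = IsMinimum (λ s → Σ (V G → Fin s) (ProperKConnected k G)) t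

SpvcIs : Graph → ℕ → Set
SpvcIs G t = IsMinimum (λ s → Σ (V G → Fin s) (StrongProperConnected G)) t

-- Two vertices on the same side of G ∨ H have every vertex of the other side
-- as a common neighbour, and two vertices on opposite sides are adjacent; so
-- G ∨ H has diameter two, a single colour already gives geodesics, and
-- same-side pairs are joined by k disjoint paths through the other side.
-- Paths that are proper for a single colour have at most one internal vertex,
-- hence a ∈ G and b ∈ H are joined by at most 1 + deg a + deg b of them, and
-- by exactly that many if we take the direct edge and all common neighbours.
-- With G and H coloured differently, take instead the direct edge and the
-- paths a, h, g, b, pairing off G ∖ {a} with H ∖ {b}: these are
-- 1 + min (|G| - 1, |H| - 1) ≥ k disjoint proper paths.
module Submission where

open import Defs
open import Data.Nat using (ℕ; zero; suc; _+_; _∸_; _≤_; _<_; z≤n; s≤s)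
open import Data.Nat.Properties
  using (≤-trans; ≤-reflexive; ≤-pred; +-mono-≤; ≮⇒≥; 1+n≰n; ∸-monoˡ-≤)
open import Data.Nat.ListAction using (sum)
open import Data.Bool using (Bool; true; false; if_then_else_)
open import Data.Bool.Properties using () renaming (_≟_ to _≟ᵇ_)
open import Data.Fin using (Fin; zero; suc; inject≤; punchIn; splitAt; join; _↑ˡ_; _↑ʳ_; fromℕ<)
  renaming (_≟_ to _≟ᶠ_)
open import Data.Fin.Properties
  using (¬Fin0; toℕ<n; inject≤-injective; injective⇒≤; punchIn-injective; punchInᵢ≢i;
         ↑ˡ-injective; ↑ʳ-injective; splitAt-join; splitAt-↑ˡ; splitAt-↑ʳ;
         splitAt⁻¹-↑ˡ; splitAt⁻¹-↑ʳ)
open import Data.Sum using (inj₁; inj₂; [_,_]′)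
open import Data.Product using (Σ; ∃; _×_; _,_; proj₁; proj₂)
open import Data.List using (List; []; _∷_; _++_; [_]; length; map; filter; lookup; allFin)
open import Data.List.Properties using (length-++; length-map)
open import Data.List.Relation.Unary.All using (All; []; _∷_)
import Data.List.Relation.Unary.All as All
import Data.List.Relation.Unary.All.Properties as All
open import Data.List.Relation.Unary.Any using (here; there; index)
open import Data.List.Relation.Unary.Any.Properties using (lookup-index)
open import Data.List.Relation.Unary.Linked using ([]; [-]; _∷_)
open import Data.List.Relation.Unary.AllPairs using ([]; _∷_)
open import Data.List.Relation.Unary.Unique.Propositional using (Unique)
import Data.List.Relation.Unary.Unique.Propositional.Properties as Unique
open import Data.List.Relation.Binary.Disjoint.Propositional using (Disjoint)
open import Data.List.Membership.Propositional using (_∈_)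
open import Data.List.Membership.Propositional.Properties
  using (∈-lookup; ∈-map⁺; ∈-map⁻; ∈-++⁺ˡ; ∈-++⁺ʳ; ∈-filter⁺; ∈-filter⁻; ∈-allFin)
open import Relation.Binary.PropositionalEquality
  using (_≡_; _≢_; refl; trans; cong; cong₂; subst; ≢-sym; module ≡-Reasoning)
  renaming (sym to ≡-sym)
open import Relation.Nullary using (¬_; yes; no)
open import Data.Empty using (⊥-elim)
open import Function using (_∘_)

Unique⇒lookup-injective : ∀ {A : Set} {xs : List A} → Unique xs →
  ∀ {i j} → lookup xs i ≡ lookup xs j → i ≡ j
Unique⇒lookup-injective (_ ∷ _) {zero} {zero} _ = refl
Unique⇒lookup-injective (x∉xs ∷ _) {zero} {suc j} eq = ⊥-elim (All.lookup x∉xs (∈-lookup j) eq)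
Unique⇒lookup-injective (x∉xs ∷ _) {suc i} {zero} eq =
  ⊥-elim (All.lookup x∉xs (∈-lookup i) (≡-sym eq))
Unique⇒lookup-injective (_ ∷ xs!) {suc i} {suc j} eq = cong suc (Unique⇒lookup-injective xs! eq)

injection⇒≤-length : ∀ {A : Set} {k} {xs : List A} (f : Fin k → A) →
  (∀ {i j} → f i ≡ f j → i ≡ j) → (∀ i → f i ∈ xs) → k ≤ length xs
injection⇒≤-length {xs = xs} f f-injective f∈xs = injective⇒≤ λ {i} {j} eq → f-injective (begin
  f i                          ≡⟨ lookup-index (f∈xs i) ⟩
  lookup xs (index (f∈xs i))   ≡⟨ cong (lookup xs) eq ⟩
  lookup xs (index (f∈xs j))   ≡⟨ lookup-index (f∈xs j) ⟨
  f j                          ∎)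
  where open ≡-Reasoning

sum-indicator≡length-filter : ∀ {A : Set} (f : A → Bool) xs →
  sum (map (λ x → if f x then 1 else 0) xs) ≡ length (filter (λ x → f x ≟ᵇ true) xs)
sum-indicator≡length-filter f [] = refl
sum-indicator≡length-filter f (x ∷ xs) with f x
... | true  = cong suc (sum-indicator≡length-filter f xs)
... | false = sum-indicator≡length-filter f xs

avoid : ∀ {n k} → Fin n → k ≤ n ∸ 1 → Fin k → Fin n
avoid {suc _} b k≤n i = punchIn b (inject≤ i k≤n)

avoid-injective : ∀ {n k} (b : Fin n) (k≤n : k ≤ n ∸ 1) {i j} →
  avoid b k≤n i ≡ avoid b k≤n j → i ≡ j
avoid-injective {suc _} b k≤n eq = inject≤-injective k≤n k≤n _ _ (punchIn-injective b _ _ eq)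

avoid≢ : ∀ {n k} (b : Fin n) (k≤n : k ≤ n ∸ 1) i → avoid b k≤n i ≢ b
avoid≢ {suc _} b k≤n i = punchInᵢ≢i b (inject≤ i k≤n)

module _ {Γ : Graph} where

  edge-sym : ∀ {u v} → Edge Γ u v → Edge Γ v u
  edge-sym {u} {v} e = trans (sym Γ v u) e

  edge⇒≢ : ∀ {u v} → Edge Γ u v → u ≢ v
  edge⇒≢ {u} e refl with () ← trans (≡-sym e) (irrefl Γ u)

neighbours : (Γ : Graph) → V Γ → List (V Γ)
neighbours Γ v = filter (λ u → adj Γ v u ≟ᵇ true) (allFin (n Γ))

deg≡length-neighbours : ∀ Γ v → deg Γ v ≡ length (neighbours Γ v)
deg≡length-neighbours Γ v = sum-indicator≡length-filter (adj Γ v) (allFin (n Γ))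

neighbours-unique : ∀ Γ v → Unique (neighbours Γ v)
neighbours-unique Γ v = Unique.filter⁺ _ (Unique.allFin⁺ (n Γ))

∈-neighbours : ∀ Γ {v u} → Edge Γ v u → u ∈ neighbours Γ v
∈-neighbours Γ {v} e = ∈-filter⁺ (λ u → adj Γ v u ≟ᵇ true) (∈-allFin _) e

neighbours-adjacent : ∀ Γ v → All (Edge Γ v) (neighbours Γ v)
neighbours-adjacent Γ v =
  All.tabulate (proj₂ ∘ ∈-filter⁻ (λ u → adj Γ v u ≟ᵇ true) {xs = allFin (n Γ)})

CommonNeighbour : (Γ : Graph) → V Γ → V Γ → V Γ → Set
CommonNeighbour Γ u v w = Edge Γ u w × Edge Γ w v

CommonNeighbour-sym : ∀ {Γ u v w} → CommonNeighbour Γ u v w → CommonNeighbour Γ v u w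
CommonNeighbour-sym {Γ} (e₁ , e₂) = edge-sym {Γ} e₂ , edge-sym {Γ} e₁

ProperPath : (Γ : Graph) {t : ℕ} → (V Γ → Fin t) → V Γ → V Γ → List (V Γ) → Set
ProperPath Γ c u v ins = IsPath Γ u v ins × VertexProper {Γ} c ins

Separated : {A : Set} → List A → List A → Set
Separated p q = p ≢ q × Disjoint p q

ProperPaths : ℕ → (Γ : Graph) {t : ℕ} → (V Γ → Fin t) → V Γ → V Γ → Set
ProperPaths k Γ c u v =
  Σ (Fin k → List (V Γ)) λ ps →
    (∀ i → ProperPath Γ c u v (ps i)) × (∀ i j → i ≢ j → Separated (ps i) (ps j))

disjoint⇒separated : ∀ {A : Set} {x : A} {p q} → x ∈ p → Disjoint p q → Separated p q
disjoint⇒separated x∈p p∩q=∅ = (λ where refl → p∩q=∅ (x∈p , x∈p)) , p∩q=∅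

Separated-sym : ∀ {A : Set} {p q : List A} → Separated p q → Separated q p
Separated-sym (p≢q , p∩q=∅) = ≢-sym p≢q , λ (x∈q , x∈p) → p∩q=∅ (x∈p , x∈q)

[]-separated : ∀ {A : Set} {q : List A} → q ≢ [] → Separated [] q
[]-separated q≢[] = ≢-sym q≢[] , λ ()

singletons-separated : ∀ {A : Set} {x y : A} → x ≢ y → Separated [ x ] [ y ]
singletons-separated x≢y = disjoint⇒separated (here refl) λ where (here refl , here refl) → x≢y refl

ProperPaths-≤ : ∀ {k m Γ t} {c : V Γ → Fin t} {u v} →
  k ≤ m → ProperPaths m Γ c u v → ProperPaths k Γ c u v
ProperPaths-≤ k≤m (ps , valid , separated) =
  ps ∘ ι , valid ∘ ι , λ i j i≢j → separated (ι i) (ι j) (i≢j ∘ inject≤-injective k≤m k≤m i j)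
  where ι = λ i → inject≤ i k≤m

module _ {Γ : Graph} {u v : V Γ} where

  direct-isPath : Edge Γ u v → IsPath Γ u v []
  direct-isPath e = e ∷ [-] , (edge⇒≢ {Γ} e ∷ []) ∷ [] ∷ []

  via-isPath : ∀ {w} → CommonNeighbour Γ u v w → u ≢ v → IsPath Γ u v [ w ]
  via-isPath (e₁ , e₂) u≢v =
    e₁ ∷ e₂ ∷ [-] , (edge⇒≢ {Γ} e₁ ∷ u≢v ∷ []) ∷ (edge⇒≢ {Γ} e₂ ∷ []) ∷ [] ∷ []

module _ {Γ : Graph} {t : ℕ} {c : V Γ → Fin t} {u v : V Γ} where

  via-paths : ∀ {m} (w : Fin m → V Γ) → (∀ {i j} → w i ≡ w j → i ≡ j) →
    (∀ i → CommonNeighbour Γ u v (w i)) → u ≢ v → ProperPaths m Γ c u v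
  via-paths w w-injective common u≢v =
    (λ i → [ w i ]) , (λ i → via-isPath {Γ} (common i) u≢v , [-]) ,
    λ i j i≢j → singletons-separated (i≢j ∘ w-injective)

  with-direct : ∀ {m} → Edge Γ u v → (P : ProperPaths m Γ c u v) → (∀ i → proj₁ P i ≢ []) →
    ProperPaths (suc m) Γ c u v
  with-direct {m} e (ps , valid , separated) nonempty = paths , valid′ , separated′
    where
    paths : Fin (suc m) → List (V Γ)
    paths zero    = []
    paths (suc i) = ps i
    valid′ : ∀ i → ProperPath Γ c u v (paths i)
    valid′ zero    = direct-isPath {Γ} e , []
    valid′ (suc i) = valid i
    separated′ : ∀ i j → i ≢ j → Separated (paths i) (paths j)
    separated′ zero    zero    0≢0 = ⊥-elim (0≢0 refl)
    separated′ zero    (suc j) _   = []-separated (nonempty j)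
    separated′ (suc i) zero    _   = Separated-sym ([]-separated (nonempty i))
    separated′ (suc i) (suc j) i≢j = separated i j (i≢j ∘ cong suc)

  direct-and-via-paths : ∀ {ws} → Edge Γ u v → Unique ws → All (CommonNeighbour Γ u v) ws →
    ProperPaths (suc (length ws)) Γ c u v
  direct-and-via-paths {ws} e ws! common = with-direct e
    (via-paths (lookup ws) (Unique⇒lookup-injective ws!) (λ i → All.lookup common (∈-lookup i))
      (edge⇒≢ {Γ} e))
    (λ _ ())

  Rung : V Γ → V Γ → Set
  Rung w x = Edge Γ u w × Edge Γ w x × Edge Γ x v × u ≢ x × w ≢ v

  rung-path : ∀ {w x} → u ≢ v → Rung w x → c w ≢ c x → ProperPath Γ c u v (w ∷ x ∷ [])
  rung-path u≢v (e₁ , e₂ , e₃ , u≢x , w≢v) cw≢cx =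
    ( e₁ ∷ e₂ ∷ e₃ ∷ [-]
    , (edge⇒≢ {Γ} e₁ ∷ u≢x ∷ u≢v ∷ []) ∷ (edge⇒≢ {Γ} e₂ ∷ w≢v ∷ []) ∷ (edge⇒≢ {Γ} e₃ ∷ []) ∷ []
      ∷ [])
    , cw≢cx ∷ [-]

  -- Different colours on the two sides of the rungs keep distinct rungs disjoint.
  ladder-paths : ∀ {m} (w x : Fin m → V Γ) →
    (∀ {i j} → w i ≡ w j → i ≡ j) → (∀ {i j} → x i ≡ x j → i ≡ j) →
    (∀ i → Rung (w i) (x i)) → (∀ i j → c (w i) ≢ c (x j)) → u ≢ v → ProperPaths m Γ c u v
  ladder-paths w x w-injective x-injective rung colours u≢v =
    (λ i → w i ∷ x i ∷ []) , (λ i → rung-path u≢v (rung i) (colours i i)) ,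
    λ i j i≢j → disjoint⇒separated (here refl) λ where
      (here refl         , here w≡w′)         → i≢j (w-injective w≡w′)
      (here refl         , there (here w≡x′)) → colours i j (cong c w≡x′)
      (there (here refl) , here x≡w′)         → colours j i (cong c (≡-sym x≡w′))
      (there (here refl) , there (here x≡x′)) → i≢j (x-injective x≡x′)

monochromatic-path∈ : ∀ {Γ} (c : V Γ → Fin 1) {u v ws ins} →
  (∀ {w} → CommonNeighbour Γ u v w → w ∈ ws) →
  ProperPath Γ c u v ins → ins ∈ [] ∷ map [_] ws
monochromatic-path∈ c {ins = []}        _        _                      = here refl
monochromatic-path∈ c {ins = w ∷ []}    complete ((e₁ ∷ e₂ ∷ _ , _) , _) =
  there (∈-map⁺ [_] (complete (e₁ , e₂)))
monochromatic-path∈ c {ins = w ∷ x ∷ _} _        (_ , cw≢cx ∷ _) with c w | c x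
... | zero | zero = ⊥-elim (cw≢cx refl)

monochromatic-bound : ∀ {Γ} (c : V Γ → Fin 1) {k u v ws} →
  (∀ {w} → CommonNeighbour Γ u v w → w ∈ ws) →
  ProperPaths k Γ c u v → k ≤ suc (length ws)
monochromatic-bound {Γ} c {ws = ws} complete (ps , valid , separated) =
  ≤-trans (injection⇒≤-length ps ps-injective (λ i → monochromatic-path∈ {Γ} c complete (valid i)))
          (≤-reflexive (cong suc (length-map [_] ws)))
  where
  ps-injective : ∀ {i j} → ps i ≡ ps j → i ≡ j
  ps-injective {i} {j} ps≡ with i ≟ᶠ j
  ... | yes i≡j = i≡j
  ... | no  i≢j = ⊥-elim (proj₁ (separated i j i≢j) ps≡)

module _ {Γ : Graph} {u v : V Γ} where

  direct-geodesic : Edge Γ u v → IsGeodesic Γ u v []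
  direct-geodesic e = direct-isPath {Γ} e , λ _ _ → s≤s z≤n

  via-geodesic : ∀ {w} → CommonNeighbour Γ u v w → u ≢ v → ¬ Edge Γ u v → IsGeodesic Γ u v [ w ]
  via-geodesic common u≢v ¬e = via-isPath {Γ} common u≢v , λ where
    []      (e ∷ _ , _) → ⊥-elim (¬e e)
    (_ ∷ _) _           → s≤s (s≤s z≤n)

diameter-two⇒strong : ∀ {Γ t} →
  (∀ {u v} → u ≢ v → ¬ Edge Γ u v → ∃ (CommonNeighbour Γ u v)) →
  (c : V Γ → Fin t) → StrongProperConnected Γ c
diameter-two⇒strong {Γ} within-two c u v u≢v with adj Γ u v ≟ᵇ true
... | yes e  = [] , direct-geodesic {Γ} e , []
... | no  ¬e = let (w , common) = within-two u≢v ¬e in [ w ] , via-geodesic {Γ} common u≢v ¬e , [-]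

strong⇒proper-1-connected : ∀ {Γ t} {c : V Γ → Fin t} →
  StrongProperConnected Γ c → ProperKConnected 1 Γ c
strong⇒proper-1-connected strong u v u≢v =
  let (ins , (path , _) , proper) = strong u v u≢v in
  (λ _ → ins) , (λ _ → path , proper) , λ where zero zero 0≢0 → ⊥-elim (0≢0 refl)

least-one-colour : ∀ Γ {Q : ∀ {t} → (V Γ → Fin t) → Set} →
  V Γ → Σ (V Γ → Fin 1) Q → IsMinimum (λ s → Σ (V Γ → Fin s) Q) 1
least-one-colour Γ v q = q , λ s (c , _) → ≤-trans (s≤s z≤n) (toℕ<n (c v))

module Join (G H : Graph) where

  left : V G → V (G ∨ H)
  left g = g ↑ˡ n H

  right : V H → V (G ∨ H)
  right h = n G ↑ʳ h

  data Side : V (G ∨ H) → Set where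
    onLeft  : ∀ g → Side (left g)
    onRight : ∀ h → Side (right h)

  side : ∀ u → Side u
  side u with splitAt (n G) u in eq
  ... | inj₁ g = subst Side (splitAt⁻¹-↑ˡ eq) (onLeft g)
  ... | inj₂ h = subst Side (splitAt⁻¹-↑ʳ eq) (onRight h)

  adj-join : ∀ x y → adj (G ∨ H) (join (n G) (n H) x) (join (n G) (n H) y) ≡ sumAdj G H x y
  adj-join x y = cong₂ (sumAdj G H) (splitAt-join (n G) (n H) x) (splitAt-join (n G) (n H) y)

  adj-left : ∀ g g′ → adj (G ∨ H) (left g) (left g′) ≡ adj G g g′
  adj-left g g′ = adj-join (inj₁ g) (inj₁ g′)

  adj-right : ∀ h h′ → adj (G ∨ H) (right h) (right h′) ≡ adj H h h′
  adj-right h h′ = adj-join (inj₂ h) (inj₂ h′)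

  left-right-edge : ∀ {g h} → Edge (G ∨ H) (left g) (right h)
  left-right-edge {g} {h} = adj-join (inj₁ g) (inj₂ h)

  right-left-edge : ∀ {g h} → Edge (G ∨ H) (right h) (left g)
  right-left-edge {g} {h} = adj-join (inj₂ h) (inj₁ g)

  left-injective : ∀ {g g′} → left g ≡ left g′ → g ≡ g′
  left-injective = ↑ˡ-injective (n H) _ _

  right-injective : ∀ {h h′} → right h ≡ right h′ → h ≡ h′
  right-injective = ↑ʳ-injective (n G) _ _

  left≢right : ∀ {g h} → left g ≢ right h
  left≢right {g} {h} eq
    with () ← trans (≡-sym (splitAt-↑ˡ (n G) g (n H)))
                    (trans (cong (splitAt (n G)) eq) (splitAt-↑ʳ (n G) (n H) h))

  diameter-two : V G → V H →
    ∀ {u v} → u ≢ v → ¬ Edge (G ∨ H) u v → ∃ (CommonNeighbour (G ∨ H) u v)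
  diameter-two g₀ h₀ {u} {v} u≢v ¬e with side u | side v
  ... | onLeft _  | onLeft _  = right h₀ , left-right-edge , right-left-edge
  ... | onRight _ | onRight _ = left g₀ , right-left-edge , left-right-edge
  ... | onLeft _  | onRight _ = ⊥-elim (¬e left-right-edge)
  ... | onRight _ | onLeft _  = ⊥-elim (¬e right-left-edge)

  join-connected : ∀ {k t} (c : V (G ∨ H) → Fin t) → k ≤ n G → k ≤ n H →
    (∀ a b → ProperPaths k (G ∨ H) c (left a) (right b)) →
    (∀ a b → ProperPaths k (G ∨ H) c (right b) (left a)) →
    ProperKConnected k (G ∨ H) c
  join-connected c k≤G k≤H cross cross′ u v u≢v with side u | side v
  ... | onLeft _  | onLeft _  =
    ProperPaths-≤ {Γ = G ∨ H} k≤H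
      (via-paths {G ∨ H} right right-injective (λ _ → left-right-edge , right-left-edge) u≢v)
  ... | onRight _ | onRight _ =
    ProperPaths-≤ {Γ = G ∨ H} k≤G
      (via-paths {G ∨ H} left left-injective (λ _ → right-left-edge , left-right-edge) u≢v)
  ... | onLeft a  | onRight b = cross a b
  ... | onRight b | onLeft a  = cross′ a b

  cross-neighbours : V G → V H → List (V (G ∨ H))
  cross-neighbours a b = map left (neighbours G a) ++ map right (neighbours H b)

  length-cross-neighbours : ∀ a b → length (cross-neighbours a b) ≡ deg G a + deg H b
  length-cross-neighbours a b = begin
    length (map left (neighbours G a) ++ map right (neighbours H b))
      ≡⟨ length-++ (map left (neighbours G a)) ⟩
    length (map left (neighbours G a)) + length (map right (neighbours H b))
      ≡⟨ cong₂ _+_ (length-map left (neighbours G a)) (length-map right (neighbours H b)) ⟩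
    length (neighbours G a) + length (neighbours H b)
      ≡⟨ cong₂ _+_ (deg≡length-neighbours G a) (deg≡length-neighbours H b) ⟨
    deg G a + deg H b ∎
    where open ≡-Reasoning

  cross-neighbours-unique : ∀ a b → Unique (cross-neighbours a b)
  cross-neighbours-unique a b = Unique.++⁺
    (Unique.map⁺ left-injective (neighbours-unique G a))
    (Unique.map⁺ right-injective (neighbours-unique H b))
    λ (x∈left , x∈right) → let (_ , _ , x≡left) = ∈-map⁻ left x∈left
                               (_ , _ , x≡right) = ∈-map⁻ right x∈right
                           in left≢right (trans (≡-sym x≡left) x≡right)

  cross-neighbours-common : ∀ a b →
    All (CommonNeighbour (G ∨ H) (left a) (right b)) (cross-neighbours a b)
  cross-neighbours-common a b = All.++⁺
    (All.map⁺ (All.map (λ e → trans (adj-left a _) e , left-right-edge) (neighbours-adjacent G a)))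
    (All.map⁺ (All.map (λ e → left-right-edge , trans (adj-right _ b) (edge-sym {H} e))
                       (neighbours-adjacent H b)))

  cross-neighbours-complete : ∀ {a b w} →
    CommonNeighbour (G ∨ H) (left a) (right b) w → w ∈ cross-neighbours a b
  cross-neighbours-complete {a} {b} {w} (e₁ , e₂) with side w
  ... | onLeft g  = ∈-++⁺ˡ (∈-map⁺ left (∈-neighbours G (trans (≡-sym (adj-left a g)) e₁)))
  ... | onRight h =
    ∈-++⁺ʳ _ (∈-map⁺ right (∈-neighbours H (edge-sym {H} (trans (≡-sym (adj-right h b)) e₂))))

  short-paths-connected : ∀ {k t} (c : V (G ∨ H) → Fin t) → k ≤ n G → k ≤ n H →
    (∀ a b → k ≤ suc (deg G a + deg H b)) → ProperKConnected k (G ∨ H) c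
  short-paths-connected c k≤G k≤H k≤degrees = join-connected c k≤G k≤H
    (λ a b → ProperPaths-≤ {Γ = G ∨ H} (k≤cross a b)
      (direct-and-via-paths {G ∨ H} left-right-edge (cross-neighbours-unique a b)
        (cross-neighbours-common a b)))
    (λ a b → ProperPaths-≤ {Γ = G ∨ H} (k≤cross a b)
      (direct-and-via-paths {G ∨ H} right-left-edge (cross-neighbours-unique a b)
        (All.map (CommonNeighbour-sym {G ∨ H}) (cross-neighbours-common a b))))
    where
    k≤cross : ∀ a b → _ ≤ suc (length (cross-neighbours a b))
    k≤cross a b = subst (λ d → _ ≤ suc d) (≡-sym (length-cross-neighbours a b)) (k≤degrees a b)

  one-colour-bound : ∀ {k} (c : V (G ∨ H) → Fin 1) → ProperKConnected k (G ∨ H) c →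
    ∀ a b → k ≤ suc (deg G a + deg H b)
  one-colour-bound c connected a b =
    subst (λ d → _ ≤ suc d) (length-cross-neighbours a b)
      (monochromatic-bound {G ∨ H} c cross-neighbours-complete (connected (left a) (right b) left≢right))

  side-colour : V (G ∨ H) → Fin 2
  side-colour u = [ (λ _ → zero) , (λ _ → suc zero) ]′ (splitAt (n G) u)

  side-colours-differ : ∀ {g h} → side-colour (left g) ≢ side-colour (right h)
  side-colours-differ {g} {h} rewrite splitAt-↑ˡ (n G) g (n H) | splitAt-↑ʳ (n G) (n H) h = λ ()

  two-colour-connected : ∀ {k} → suc k ≤ n G → suc k ≤ n H →
    ProperKConnected (suc k) (G ∨ H) side-colour
  two-colour-connected {k} k<G k<H = join-connected side-colour k<G k<H
    (λ a b → with-direct {G ∨ H} left-right-edge (ladder a b) (λ _ ()))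
    (λ a b → with-direct {G ∨ H} right-left-edge (ladder′ a b) (λ _ ()))
    where
    k≤G : k ≤ n G ∸ 1
    k≤G = ∸-monoˡ-≤ 1 k<G
    k≤H : k ≤ n H ∸ 1
    k≤H = ∸-monoˡ-≤ 1 k<H

    ladder : ∀ a b → ProperPaths k (G ∨ H) side-colour (left a) (right b)
    ladder a b = ladder-paths {G ∨ H} (right ∘ avoid b k≤H) (left ∘ avoid a k≤G)
      (avoid-injective b k≤H ∘ right-injective) (avoid-injective a k≤G ∘ left-injective)
      (λ i → left-right-edge , right-left-edge , left-right-edge ,
             avoid≢ a k≤G i ∘ ≡-sym ∘ left-injective , avoid≢ b k≤H i ∘ right-injective)
      (λ _ _ → side-colours-differ ∘ ≡-sym) left≢right

    ladder′ : ∀ a b → ProperPaths k (G ∨ H) side-colour (right b) (left a)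
    ladder′ a b = ladder-paths {G ∨ H} (left ∘ avoid a k≤G) (right ∘ avoid b k≤H)
      (avoid-injective a k≤G ∘ left-injective) (avoid-injective b k≤H ∘ right-injective)
      (λ i → right-left-edge , left-right-edge , right-left-edge ,
             avoid≢ b k≤H i ∘ ≡-sym ∘ right-injective , avoid≢ a k≤G i ∘ left-injective)
      (λ _ _ → side-colours-differ) (left≢right ∘ ≡-sym)

join-pvc₁≡1-spvc≡1 : ∀ G H → V G → V H → PvcIs 1 (G ∨ H) 1 × SpvcIs (G ∨ H) 1
join-pvc₁≡1-spvc≡1 G H g₀ h₀ =
  least-one-colour (G ∨ H) (left g₀) (one-colour , strong⇒proper-1-connected {G ∨ H} strong) ,
  least-one-colour (G ∨ H) (left g₀) (one-colour , strong)
  where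
  open Join G H
  one-colour : V (G ∨ H) → Fin 1
  one-colour _ = zero
  strong : StrongProperConnected (G ∨ H) one-colour
  strong = diameter-two⇒strong {G ∨ H} (diameter-two g₀ h₀) one-colour

join-pvc≡1 : ∀ G H {k} → V G → k ≤ n G → k ≤ n H →
  (∀ a b → k ≤ suc (deg G a + deg H b)) → PvcIs k (G ∨ H) 1
join-pvc≡1 G H a k≤G k≤H k≤degrees =
  least-one-colour (G ∨ H) (left a) ((λ _ → zero) , short-paths-connected _ k≤G k≤H k≤degrees)
  where open Join G H

join-pvc≡2 : ∀ G H {k} (a : V G) (b : V H) → suc k ≤ n G → suc k ≤ n H →
  deg G a + deg H b < k → PvcIs (suc k) (G ∨ H) 2
join-pvc≡2 G H a b k<G k<H degrees<k = (side-colour , two-colour-connected k<G k<H) , at-least-two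
  where
  open Join G H
  at-least-two : ∀ s → Σ (V (G ∨ H) → Fin s) (ProperKConnected (suc _) (G ∨ H)) → 2 ≤ s
  at-least-two zero          (c , _)         = ⊥-elim (¬Fin0 (c (left a)))
  at-least-two (suc zero)    (c , connected) = ⊥-elim (1+n≰n (≤-trans degrees<k k≤degrees))
    where k≤degrees = ≤-pred (one-colour-bound c connected a b)
  at-least-two (suc (suc s)) _               = s≤s (s≤s z≤n)

theorem2p1 :
    (∀ (G H : Graph) → 1 ≤ n G → 1 ≤ n H → ¬ Complete (G ∨ H) →
       PvcIs 1 (G ∨ H) 1 × SpvcIs (G ∨ H) 1)
    ×
    (∀ (G H : Graph) (k dG dH : ℕ) → 2 ≤ k → k ≤ n G → k ≤ n H →
       IsMinDegree G dG → IsMinDegree H dH →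
       (dG + dH < k ∸ 1 → PvcIs k (G ∨ H) 2) ×
       (¬ (dG + dH < k ∸ 1) → PvcIs k (G ∨ H) 1))
theorem2p1 =
  (λ G H 1≤G 1≤H _ → join-pvc₁≡1-spvc≡1 G H (fromℕ< 1≤G) (fromℕ< 1≤H)) ,
  λ where
    G H (suc k) dG dH _ k<G k<H ((a , deg-a) , min-G) ((b , deg-b) , min-H) →
      (λ d<k → join-pvc≡2 G H a b k<G k<H
        (subst (_< k) (cong₂ _+_ (≡-sym deg-a) (≡-sym deg-b)) d<k)) ,
      (λ d≮k → join-pvc≡1 G H a k<G k<H λ a′ b′ →
        s≤s (≤-trans (≮⇒≥ d≮k) (+-mono-≤ (min-G a′) (min-H b′))))
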